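{- Let $T$ be a tree with maximum degree $\Delta$ and $|V(T)|\ge 2$, and let $p$ be an integer with $p\ge 2\Delta$. Then for every integer $\lambda\in\{\Delta+p-1,\ldots,2\Delta+p-2\}$, no label in $\{2\Delta-1,\ldots,p-1\}$ is used by any $\lambda$-$L(p,1)$-labeling of $T$.
   Context: A $\lambda$-$L(p,1)$-labeling of a graph $G$ is a map $f:V(G)\to\{0,1,\ldots,\lambda\}$ such that $|f(x)-f(y)|\ge p$ whenever $x$ and $y$ are adjacent and $|f(x)-f(y)|\ge 1$ whenever $x$ and $y$ are at distance $2$. -}

module Defs where

open import Data.Nat using (ℕ; suc; _+_; _*_; _∸_; _≤_; _≥_; ∣_-_∣)
open import Data.Fin using (Fin)
open import Data.Bool using (Bool; true; false)
open import Data.List using (List; []; _∷_; length; filterᵇ; allFin)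
open import Data.List.Relation.Unary.Unique.Propositional using (Unique)
open import Data.Product using (Σ; ∃; _×_; _,_)
open import Data.Empty using (⊥)
open import Relation.Nullary using (¬_)
open import Relation.Binary.PropositionalEquality using (_≡_; _≢_)

record Graph : Set where
  field
    n       : ℕ
    adj     : Fin n → Fin n → Bool
    symm    : ∀ u v → adj u v ≡ adj v u
    irrefl  : ∀ v → adj v v ≡ false

open Graph public

Adj : (G : Graph) → Fin (n G) → Fin (n G) → Set
Adj G u v = adj G u v ≡ true

deg : (G : Graph) → Fin (n G) → ℕ
deg G v = length (filterᵇ (adj G v) (allFin (n G)))

IsMaxDegree : (G : Graph) → ℕ → Set
IsMaxDegree G Δ = (∀ v → deg G v ≤ Δ) × (∃ λ v → deg G v ≡ Δ)

data Walk (G : Graph) : Fin (n G) → Fin (n G) → Set where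
  here : ∀ {u} → Walk G u u
  step : ∀ {u w v} → Adj G u w → Walk G w v → Walk G u v

Connected : Graph → Set
Connected G = ∀ u v → Walk G u v

-- A path given by a list of vertices, consecutive ones adjacent;
-- PathFromTo G x xs y : the vertex sequence x ∷ xs ends at y
data PathFromTo (G : Graph) : Fin (n G) → List (Fin (n G)) → Fin (n G) → Set where
  end  : ∀ {x} → PathFromTo G x [] x
  cons : ∀ {x w ws y} → Adj G x w → PathFromTo G w ws y → PathFromTo G x (w ∷ ws) y

HasCycle : Graph → Set
HasCycle G = Σ (Fin (n G)) λ x → Σ (List (Fin (n G))) λ xs → Σ (Fin (n G)) λ y →
  PathFromTo G x xs y × Adj G y x × Unique (x ∷ xs) × 2 ≤ length xs

IsTree : Graph → Set
IsTree G = Connected G × ¬ HasCycle G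

Dist2 : (G : Graph) → Fin (n G) → Fin (n G) → Set
Dist2 G x y = x ≢ y × ¬ Adj G x y × ∃ λ w → Adj G x w × Adj G w y

IsLabeling : (G : Graph) → (p lam : ℕ) → (Fin (n G) → ℕ) → Set
IsLabeling G p lam f =
  (∀ v → f v ≤ lam) ×
  (∀ x y → Adj G x y → p ≤ ∣ f x - f y ∣) ×
  (∀ x y → Dist2 G x y → 1 ≤ ∣ f x - f y ∣)

module Submission where

-- Let f be a λ-L(p,1)-labeling of T with λ ≤ 2Δ+p-2 and
-- suppose some vertex v has 2Δ-1 ≤ f(v) ≤ p-1.  Since T is connected with at
-- least two vertices, v has a neighbour u, so Δ ≥ 1 and |f(v) - f(u)| ≥ p.
-- As f(v) < p, the label f(u) cannot lie p below f(v); hence it lies p above: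
--   f(u) ≥ f(v) + p ≥ 2Δ - 1 + p > 2Δ + p - 2 ≥ λ,
-- contradicting f(u) ≤ λ.

open import Defs
open import Data.Nat using (ℕ; _+_; _*_; _∸_; _≤_; _<_; suc; z≤n; s≤s; ∣_-_∣)
open import Data.Nat.Properties
open import Data.Fin using (Fin; zero; suc)
open import Data.Bool.Properties using (T-≡)
open import Data.List using (List; _∷_; length)
open import Data.List.Membership.Propositional using (_∈_)
open import Data.List.Membership.Propositional.Properties using (∈-allFin; ∈-filter⁺)
open import Data.Product using (_×_; _,_; ∃)
open import Data.Sum using (inj₁; inj₂)
open import Data.Empty using (⊥-elim)
open import Function using (Equivalence)
open import Relation.Nullary using (¬_)
open import Relation.Nullary.Decidable using (T?)
open import Relation.Binary.PropositionalEquality using (_≡_; _≢_; refl; sym; subst)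

another-vertex : ∀ {m} → 2 ≤ m → (v : Fin m) → ∃ λ w → w ≢ v
another-vertex (s≤s (s≤s _)) zero    = suc zero , λ ()
another-vertex (s≤s (s≤s _)) (suc v) = zero , λ ()

walk-first-neighbour : (G : Graph) {v w : Fin (n G)} → w ≢ v → Walk G v w →
  ∃ λ u → Adj G v u
walk-first-neighbour G w≢v here                 = ⊥-elim (w≢v refl)
walk-first-neighbour G w≢v (step {w = u} v~u _) = u , v~u

connected⇒neighbour : (G : Graph) → Connected G → 2 ≤ n G →
  (v : Fin (n G)) → ∃ λ u → Adj G v u
connected⇒neighbour G conn two v with another-vertex two v
... | w , w≢v = walk-first-neighbour G w≢v (conn v w)

-- A vertex with a neighbour has degree at least one: the neighbour survives
-- the filter defining the degree.
neighbour⇒deg≥1 : (G : Graph) {v u : Fin (n G)} → Adj G v u → 1 ≤ deg G v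
neighbour⇒deg≥1 G {v} {u} v~u =
  nonempty (∈-filter⁺ (λ x → T? (adj G v x)) (∈-allFin u) (Equivalence.from T-≡ v~u))
  where
  nonempty : ∀ {A : Set} {x : A} {xs : List A} → x ∈ xs → 1 ≤ length xs
  nonempty {xs = _ ∷ _} _ = s≤s z≤n

far-label-above : ∀ {a b p} → a < p → p ≤ ∣ a - b ∣ → p + a ≤ b
far-label-above {a} {b} {p} a<p gap with ≤-total a b
... | inj₁ a≤b = m≤o∸n⇒m+n≤o p a≤b (subst (p ≤_) (m≤n⇒∣m-n∣≡n∸m a≤b) gap)
... | inj₂ b≤a = ⊥-elim (<⇒≱ a<p (≤-trans gap ∣a-b∣≤a))
  where
  ∣a-b∣≤a : ∣ a - b ∣ ≤ a
  ∣a-b∣≤a = subst (_≤ a) (sym (m≤n⇒∣n-m∣≡n∸m b≤a)) (m∸n≤m a b)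

≤pred⇒< : ∀ {m p} → 1 ≤ p → m ≤ p ∸ 1 → m < p
≤pred⇒< {p = suc _} _ m≤ = s≤s m≤

pred+p≡suc-pred₂ : ∀ {k} p → 2 ≤ k → k ∸ 1 + p ≡ suc (k + p ∸ 2)
pred+p≡suc-pred₂ _ (s≤s (s≤s _)) = refl

lemma6p1 : (T : Graph) → IsTree T → 2 ≤ n T →
    (Δ : ℕ) → IsMaxDegree T Δ →
    (p : ℕ) → 2 * Δ ≤ p →
    (lam : ℕ) → Δ + p ∸ 1 ≤ lam → lam ≤ 2 * Δ + p ∸ 2 →
    (f : Fin (n T) → ℕ) → IsLabeling T p lam f →
    (v : Fin (n T)) → ¬ (2 * Δ ∸ 1 ≤ f v × f v ≤ p ∸ 1)
lemma6p1 T (conn , _) two Δ (deg≤Δ , _) p 2Δ≤p lam _ lam≤ f (f≤lam , fadj , _) v (lo , hi)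
  with connected⇒neighbour T conn two v
... | u , v~u = <-irrefl refl (begin-strict
    f u                ≤⟨ f≤lam u ⟩
    lam                ≤⟨ lam≤ ⟩
    2 * Δ + p ∸ 2      <⟨ ≤-reflexive (sym (pred+p≡suc-pred₂ p 2≤2Δ)) ⟩
    2 * Δ ∸ 1 + p      ≤⟨ +-monoˡ-≤ p lo ⟩
    f v + p            ≡⟨ +-comm (f v) p ⟩
    p + f v            ≤⟨ far-label-above fv<p (fadj v u v~u) ⟩
    f u                ∎)
  where
  open ≤-Reasoning
  2≤2Δ : 2 ≤ 2 * Δ
  2≤2Δ = *-monoʳ-≤ 2 (≤-trans (neighbour⇒deg≥1 T v~u) (deg≤Δ v))
  fv<p : f v < p
  fv<p = ≤pred⇒< (≤-trans (s≤s z≤n) (≤-trans 2≤2Δ 2Δ≤p)) hi
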